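{- Let $\{P_n(x)\}_{n\ge 1}$ be the sequence defined in the context. For every odd $n\ge3$ and every integer $k\ge0$, $P_n(k)\equiv P_n(0)\pmod n$.
   Context: The sequence $\{P_n(x)\}_{n\ge1}$ of rational functions of $x$ is defined by $P_1=P_2=1$ and, for $n\ge 2$: if $n$ is odd, $4(2x+n)P_{n+1}(x)=2(x+n)P_n(x)+(2x+n)P_n(x+1)+(4x+n)\ell_n(x)$; if $n$ is even, $4P_{n+1}(x)=4(x+n)P_n(x)+2(2x+n+1)P_n(x+1)+(4x+n)\ell_{n-1}(x)$. Here for odd $r\ge1$, $\ell_r(x)=\prod_{j=1}^{(r-1)/2}(x+j)$ (the empty product equals $1$). (Each $P_n$ is a polynomial with integer coefficients.) -}

module Defs where

open import Data.Nat as ℕ using (ℕ; zero; suc; ⌊_/2⌋)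
open import Data.Integer using (ℤ; +_)
open import Data.Rational using (ℚ; _/_; _+_; _*_; 1ℚ)
open import Data.Bool using (Bool; true; false; if_then_else_)

q : ℕ → ℚ
q a = + a / 1

isOdd : ℕ → Bool
isOdd zero = false
isOdd (suc n) = Data.Bool.not (isOdd n)

prodShift : ℕ → ℕ → ℕ
prodShift zero k = 1
prodShift (suc h) k = (k ℕ.+ suc h) ℕ.* prodShift h k

-- ℓ_r(k) = ∏_{j=1}^{(r-1)/2} (k + j)  (used only for odd r)
ell : ℕ → ℕ → ℚ
ell r k = q (prodShift ⌊ ℕ.pred r /2⌋ k)

-- P n k = P_n(k), the value of the rational function P_n at the
-- non-negative integer k (all denominators 4(2k+n) are non-zero there).
-- P 0 is an unused dummy value.
P : ℕ → ℕ → ℚ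
P zero k = 1ℚ
P (suc zero) k = 1ℚ
P (suc (suc zero)) k = 1ℚ
P (suc (suc (suc m))) k =
  if isOdd (suc (suc m))
  then (q (2 ℕ.* (k ℕ.+ (suc (suc m)))) * P (suc (suc m)) k + q (2 ℕ.* k ℕ.+ (suc (suc m))) * P (suc (suc m)) (suc k)
          + q (4 ℕ.* k ℕ.+ (suc (suc m))) * ell (suc (suc m)) k)
       * (+ 1 / (4 ℕ.* suc (suc (m ℕ.+ 2 ℕ.* k))))
  else (q (4 ℕ.* (k ℕ.+ (suc (suc m)))) * P (suc (suc m)) k + q (2 ℕ.* (2 ℕ.* k ℕ.+ (suc (suc m)) ℕ.+ 1)) * P (suc (suc m)) (suc k)
          + q (4 ℕ.* k ℕ.+ (suc (suc m))) * ell (ℕ.pred (suc (suc m))) k)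
       * (+ 1 / 4)

{-# OPTIONS --safe #-}
-- For n = 2r+2 and n = 2r+3 the values of P_n at natural numbers are given by integer
-- closed forms: P_{2r+3}(x) = 2(x+2r+2) P_{2r+2}(x) + x ℓ_{2r+1}(x) and
-- P_{2r+4}(x) = P_{2r+3}(x) − x P_{2r+2}(x+1). After clearing denominators, both defining
-- recurrences reduce to the shift identity
--   (2x+2r+3) P_{2r+2}(x+1) = 2(x+2r+2) P_{2r+2}(x) − (r+1) ℓ_{2r+1}(x),
-- which is proved by induction on r. The same identity gives, for odd n = 2r+3,
-- P_n(x+1) − P_n(x) = n P_{n−1}(x+1); summing over x, P_n(k) − P_n(0) = n Σ_{j=1}^{k} P_{n−1}(j).
module Submission where

open import Data.Nat as ℕ using (ℕ; zero; suc; _≥_; s≤s; NonZero)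
open import Data.Nat.Properties using (+-suc; n≡⌊n+n/2⌋)
open import Data.Bool using (true; false; not)
open import Data.Bool.Properties using (not-involutive; if-cong)
open import Data.Product using (∃; _,_)
open import Relation.Binary.PropositionalEquality
  using (_≡_; refl; sym; trans; cong; cong₂; subst; module ≡-Reasoning)
open import Defs

isOdd-suc-suc : ∀ n → isOdd (suc (suc n)) ≡ isOdd n
isOdd-suc-suc n = not-involutive (isOdd n)

isOdd-double : ∀ r → isOdd (r ℕ.+ r) ≡ false
isOdd-double zero    = refl
isOdd-double (suc r) =
  trans (cong (λ t → isOdd (suc t)) (+-suc r r)) (trans (isOdd-suc-suc (r ℕ.+ r)) (isOdd-double r))

odd⇒suc-double : ∀ n → isOdd n ≡ true → ∃ λ r → n ≡ suc (r ℕ.+ r)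
odd⇒suc-double (suc zero)    _ = zero , refl
odd⇒suc-double (suc (suc n)) odd with odd⇒suc-double n (trans (sym (isOdd-suc-suc n)) odd)
... | r , refl = suc r , cong (λ t → suc (suc t)) (sym (+-suc r r))

odd≥3⇒suc-double : ∀ {n} → n ≥ 3 → isOdd n ≡ true →
  ∃ λ r → n ≡ suc (suc (suc (r ℕ.+ r)))
odd≥3⇒suc-double {n} n≥3 odd with odd⇒suc-double n odd
... | suc r , refl = r , cong suc (+-suc (suc r) r)
... | zero  , refl with n≥3
...   | s≤s ()

module IntegerModel where

  open import Data.Integer using (ℤ; +_; _+_; _*_; _-_; -_)
  open import Data.Integer.Properties using (pos-*; i-j≡0⇒i≡j)
  open import Data.Integer.Tactic.RingSolver using (solve-∀)

  linear-combination₁ : ∀ {g h x₀ y₀ : ℤ} a →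
    g - h ≡ a * (x₀ - y₀) → x₀ ≡ y₀ → g ≡ h
  linear-combination₁ {g} {h} {y₀ = y₀} a eq refl =
    i-j≡0⇒i≡j g h (trans eq (vanish a y₀))
    where
    vanish : ∀ a y₀ → a * (y₀ - y₀) ≡ + 0
    vanish = solve-∀

  linear-combination₂ : ∀ {g h x₀ y₀ x₁ y₁ : ℤ} a b →
    g - h ≡ a * (x₀ - y₀) + b * (x₁ - y₁) → x₀ ≡ y₀ → x₁ ≡ y₁ → g ≡ h
  linear-combination₂ {g} {h} {y₀ = y₀} {y₁ = y₁} a b eq refl refl =
    i-j≡0⇒i≡j g h (trans eq (vanish a b y₀ y₁))
    where
    vanish : ∀ a b y₀ y₁ → a * (y₀ - y₀) + b * (y₁ - y₁) ≡ + 0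
    vanish = solve-∀

  linear-combination₃ : ∀ {g h x₀ y₀ x₁ y₁ x₂ y₂ : ℤ} a b c →
    g - h ≡ a * (x₀ - y₀) + b * (x₁ - y₁) + c * (x₂ - y₂) →
    x₀ ≡ y₀ → x₁ ≡ y₁ → x₂ ≡ y₂ → g ≡ h
  linear-combination₃ {g} {h} {y₀ = y₀} {y₁ = y₁} {y₂ = y₂} a b c eq refl refl refl =
    i-j≡0⇒i≡j g h (trans eq (vanish a b c y₀ y₁ y₂))
    where
    vanish : ∀ a b c y₀ y₁ y₂ → a * (y₀ - y₀) + b * (y₁ - y₁) + c * (y₂ - y₂) ≡ + 0
    vanish = solve-∀

  -- ℓ r x = ℓ_{2r+1}(x) = ∏_{j=1}^{r} (x + j)
  ℓ : ℕ → ℕ → ℤ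
  ℓ zero    x = + 1
  ℓ (suc r) x = (+ x + + suc r) * ℓ r x

  ℓ≡prodShift : ∀ r x → ℓ r x ≡ + prodShift r x
  ℓ≡prodShift zero    x = refl
  ℓ≡prodShift (suc r) x =
    trans (cong (+ (x ℕ.+ suc r) *_) (ℓ≡prodShift r x)) (sym (pos-* (x ℕ.+ suc r) (prodShift r x)))

  ℓ-shift : ∀ r x → + suc x * ℓ r (suc x) ≡ ℓ (suc r) x
  ℓ-shift zero    x = base (+ x)
    where
    base : ∀ X → (+ 1 + X) * + 1 ≡ (X + + 1) * + 1
    base = solve-∀
  ℓ-shift (suc r) x = begin
    + suc x * ((+ suc x + + suc r) * ℓ r (suc x))  ≡⟨ regroup (+ x) (+ r) (ℓ r (suc x)) ⟩
    (+ x + + suc (suc r)) * (+ suc x * ℓ r (suc x)) ≡⟨ cong ((+ x + + suc (suc r)) *_) (ℓ-shift r x) ⟩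
    (+ x + + suc (suc r)) * ℓ (suc r) x             ∎
    where
    open ≡-Reasoning
    regroup : ∀ X R L → (+ 1 + X) * (((+ 1 + X) + (+ 1 + R)) * L) ≡ (X + (+ 2 + R)) * ((+ 1 + X) * L)
    regroup = solve-∀

  mutual
    Podd : ℕ → ℕ → ℤ
    Podd r x = + 2 * (+ x + + suc (suc (r ℕ.+ r))) * Peven r x + + x * ℓ r x

    Peven : ℕ → ℕ → ℤ
    Peven zero    x = + 1
    Peven (suc r) x = Podd r x - + x * Peven r (suc x)

  Peven-shift : ∀ r x →
    (+ 2 * + x + + suc (suc (suc (r ℕ.+ r)))) * Peven r (suc x)
      ≡ + 2 * (+ x + + suc (suc (r ℕ.+ r))) * Peven r x - + suc r * ℓ r x
  Peven-shift zero    x = base (+ x)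
    where
    base : ∀ X → (+ 2 * X + + 3) * + 1 ≡ + 2 * (X + + 2) * + 1 - + 1 * + 1
    base = solve-∀
  Peven-shift (suc r) x rewrite +-suc r r =
    linear-combination₃ (+ 2 * (+ x + + 2 * + r + + 4)) (- (+ x + + 1)) (+ 2 * + x + + 3 * + r + + 6)
      (certificate (+ x) (+ r) (Peven r x) (Peven r (suc x)) (Peven r (suc (suc x))) (ℓ r x) (ℓ r (suc x)))
      (Peven-shift r x) (Peven-shift r (suc x)) (ℓ-shift r x)
    where
    certificate : ∀ X R e₀ e₁ e₂ l₀ l₁ → let M = + 2 + (R + R) in
      (+ 2 * X + (+ 5 + (R + R))) * ((+ 2 * ((+ 1 + X) + M) * e₁ + (+ 1 + X) * l₁) - (+ 1 + X) * e₂)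
        - (+ 2 * (X + (+ 4 + (R + R))) * ((+ 2 * (X + M) * e₀ + X * l₀) - X * e₁)
           - (+ 2 + R) * ((X + (+ 1 + R)) * l₀))
      ≡ + 2 * (X + + 2 * R + + 4) * ((+ 2 * X + (+ 1 + M)) * e₁ - (+ 2 * (X + M) * e₀ - (+ 1 + R) * l₀))
        + (- (X + + 1))
          * ((+ 2 * (+ 1 + X) + (+ 1 + M)) * e₂ - (+ 2 * ((+ 1 + X) + M) * e₁ - (+ 1 + R) * l₁))
        + (+ 2 * X + + 3 * R + + 6) * ((+ 1 + X) * l₁ - (X + (+ 1 + R)) * l₀)
    certificate = solve-∀

  Podd-step : ∀ r x → Podd r (suc x) ≡ Podd r x + + suc (suc (suc (r ℕ.+ r))) * Peven r (suc x)
  Podd-step r x =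
    linear-combination₂ (+ 1) (+ 1)
      (certificate (+ x) (+ r) (Peven r x) (Peven r (suc x)) (ℓ r x) (ℓ r (suc x)))
      (Peven-shift r x) (ℓ-shift r x)
    where
    certificate : ∀ X R e₀ e₁ l₀ l₁ → let M = + 2 + (R + R) in
      (+ 2 * ((+ 1 + X) + M) * e₁ + (+ 1 + X) * l₁) - ((+ 2 * (X + M) * e₀ + X * l₀) + (+ 1 + M) * e₁)
      ≡ + 1 * ((+ 2 * X + (+ 1 + M)) * e₁ - (+ 2 * (X + M) * e₀ - (+ 1 + R) * l₀))
        + + 1 * ((+ 1 + X) * l₁ - (X + (+ 1 + R)) * l₀)
    certificate = solve-∀

  recurrence-even : ∀ r k → let n = + suc (suc (r ℕ.+ r)) in
    + 4 * (+ k + n) * Peven r k + + 2 * (+ 2 * + k + n + + 1) * Peven r (suc k) + (+ 4 * + k + n) * ℓ r k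
      ≡ Podd r k * + 4
  recurrence-even r k =
    linear-combination₁ (+ 2)
      (certificate (+ k) (+ r) (Peven r k) (Peven r (suc k)) (ℓ r k))
      (Peven-shift r k)
    where
    certificate : ∀ K R e₀ e₁ l₀ → let M = + 2 + (R + R) in
      (+ 4 * (K + M) * e₀ + + 2 * (+ 2 * K + M + + 1) * e₁ + (+ 4 * K + M) * l₀)
        - (+ 2 * (K + M) * e₀ + K * l₀) * + 4
      ≡ + 2 * ((+ 2 * K + (+ 1 + M)) * e₁ - (+ 2 * (K + M) * e₀ - (+ 1 + R) * l₀))
    certificate = solve-∀

  recurrence-odd : ∀ r k → let n = + suc (suc (suc (r ℕ.+ r))) in
    + 2 * (+ k + n) * Podd r k + (+ 2 * + k + n) * Podd r (suc k) + (+ 4 * + k + n) * ℓ (suc r) k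
      ≡ Peven (suc r) k * (+ 4 * (n + + 2 * + k))
  recurrence-odd r k =
    linear-combination₂ (+ 6 * + k + + 4 * + r + + 6) (+ 2 * + k + + 2 * + r + + 3)
      (certificate (+ k) (+ r) (Peven r k) (Peven r (suc k)) (ℓ r k) (ℓ r (suc k)))
      (Peven-shift r k) (ℓ-shift r k)
    where
    certificate : ∀ K R e₀ e₁ l₀ l₁ → let M = + 2 + (R + R); N = + 1 + M in
      (+ 2 * (K + N) * (+ 2 * (K + M) * e₀ + K * l₀)
        + (+ 2 * K + N) * (+ 2 * ((+ 1 + K) + M) * e₁ + (+ 1 + K) * l₁)
        + (+ 4 * K + N) * ((K + (+ 1 + R)) * l₀))
        - ((+ 2 * (K + M) * e₀ + K * l₀) - K * e₁) * (+ 4 * (N + + 2 * K))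
      ≡ (+ 6 * K + + 4 * R + + 6) * ((+ 2 * K + N) * e₁ - (+ 2 * (K + M) * e₀ - (+ 1 + R) * l₀))
        + (+ 2 * K + + 2 * R + + 3) * ((+ 1 + K) * l₁ - (K + (+ 1 + R)) * l₀)
    certificate = solve-∀

  partialSum : (ℕ → ℤ) → ℕ → ℤ
  partialSum g zero    = + 0
  partialSum g (suc k) = partialSum g k + g (suc k)

  telescope : ∀ (f g : ℕ → ℤ) c → (∀ x → f (suc x) ≡ f x + c * g (suc x)) →
    ∀ k → f k - f 0 ≡ c * partialSum g k
  telescope f g c step zero    = empty (f 0) c
    where
    empty : ∀ a c → a - a ≡ c * + 0
    empty = solve-∀
  telescope f g c step (suc k) =
    linear-combination₂ (+ 1) (+ 1)
      (certificate (f (suc k)) (f k) (f 0) c (g (suc k)) (partialSum g k))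
      (step k) (telescope f g c step k)
    where
    certificate : ∀ f₁ f₀ a c g s →
      f₁ - a - c * (s + g) ≡ + 1 * (f₁ - (f₀ + c * g)) + + 1 * ((f₀ - a) - c * s)
    certificate = solve-∀

open IntegerModel

open import Data.Integer as ℤ using (ℤ; +_)
open import Data.Integer.Properties using (pos-*)
open import Data.Integer.Tactic.RingSolver using (solve-∀)
open import Data.Rational using (ℚ; _+_; _-_; _*_; -_; _/_; 1ℚ; fromℚᵘ; toℚᵘ)
open import Data.Rational.Properties
  using (toℚᵘ-injective; toℚᵘ-fromℚᵘ; fromℚᵘ-cong; toℚᵘ-homo-+; toℚᵘ-homo-*; toℚᵘ-homo‿-;
         *-assoc; *-identityʳ)
import Data.Rational.Unnormalised as ℚᵘ
import Data.Rational.Unnormalised.Properties as ℚᵘ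

fromℚᵘ-homo-+ : ∀ p q → fromℚᵘ (p ℚᵘ.+ q) ≡ fromℚᵘ p + fromℚᵘ q
fromℚᵘ-homo-+ p q = toℚᵘ-injective (begin
  toℚᵘ (fromℚᵘ (p ℚᵘ.+ q))             ≈⟨ toℚᵘ-fromℚᵘ (p ℚᵘ.+ q) ⟩
  p ℚᵘ.+ q                              ≈⟨ ℚᵘ.+-cong (toℚᵘ-fromℚᵘ p) (toℚᵘ-fromℚᵘ q) ⟨
  toℚᵘ (fromℚᵘ p) ℚᵘ.+ toℚᵘ (fromℚᵘ q)  ≈⟨ toℚᵘ-homo-+ (fromℚᵘ p) (fromℚᵘ q) ⟨
  toℚᵘ (fromℚᵘ p + fromℚᵘ q)            ∎)
  where open ℚᵘ.≃-Reasoning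

fromℚᵘ-homo-* : ∀ p q → fromℚᵘ (p ℚᵘ.* q) ≡ fromℚᵘ p * fromℚᵘ q
fromℚᵘ-homo-* p q = toℚᵘ-injective (begin
  toℚᵘ (fromℚᵘ (p ℚᵘ.* q))             ≈⟨ toℚᵘ-fromℚᵘ (p ℚᵘ.* q) ⟩
  p ℚᵘ.* q                              ≈⟨ ℚᵘ.*-cong (toℚᵘ-fromℚᵘ p) (toℚᵘ-fromℚᵘ q) ⟨
  toℚᵘ (fromℚᵘ p) ℚᵘ.* toℚᵘ (fromℚᵘ q)  ≈⟨ toℚᵘ-homo-* (fromℚᵘ p) (fromℚᵘ q) ⟨
  toℚᵘ (fromℚᵘ p * fromℚᵘ q)            ∎)
  where open ℚᵘ.≃-Reasoning

fromℚᵘ-homo‿- : ∀ p → fromℚᵘ (ℚᵘ.- p) ≡ - fromℚᵘ p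
fromℚᵘ-homo‿- p = toℚᵘ-injective (begin
  toℚᵘ (fromℚᵘ (ℚᵘ.- p))  ≈⟨ toℚᵘ-fromℚᵘ (ℚᵘ.- p) ⟩
  ℚᵘ.- p                   ≈⟨ ℚᵘ.-‿cong (toℚᵘ-fromℚᵘ p) ⟨
  ℚᵘ.- toℚᵘ (fromℚᵘ p)     ≈⟨ toℚᵘ-homo‿- (fromℚᵘ p) ⟨
  toℚᵘ (- fromℚᵘ p)        ∎)
  where open ℚᵘ.≃-Reasoning

ι : ℤ → ℚ
ι i = i / 1

ι-+ : ∀ i j → ι (i ℤ.+ j) ≡ ι i + ι j
ι-+ i j = trans (fromℚᵘ-cong {(i ℤ.+ j) ℚᵘ./ 1} {(i ℚᵘ./ 1) ℚᵘ.+ (j ℚᵘ./ 1)}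
  (ℚᵘ.*≡* (unit-denominators i j))) (fromℚᵘ-homo-+ (i ℚᵘ./ 1) (j ℚᵘ./ 1))
  where
  unit-denominators : ∀ i j → (i ℤ.+ j) ℤ.* + 1 ≡ (i ℤ.* + 1 ℤ.+ j ℤ.* + 1) ℤ.* + 1
  unit-denominators = solve-∀

ι-* : ∀ i j → ι (i ℤ.* j) ≡ ι i * ι j
ι-* i j = fromℚᵘ-homo-* (i ℚᵘ./ 1) (j ℚᵘ./ 1)

ι-- : ∀ i j → ι (i ℤ.- j) ≡ ι i - ι j
ι-- i j = trans (ι-+ i (ℤ.- j)) (cong (_+_ (ι i)) (fromℚᵘ-homo‿- (j ℚᵘ./ 1)))

ι-*-inverse : ∀ d .{{_ : NonZero d}} → ι (+ d) * (+ 1 / d) ≡ 1ℚ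
ι-*-inverse (suc d) = trans (sym (fromℚᵘ-homo-* (+ suc d ℚᵘ./ 1) (+ 1 ℚᵘ./ suc d)))
  (fromℚᵘ-cong {(+ suc d ℚᵘ./ 1) ℚᵘ.* (+ 1 ℚᵘ./ suc d)} {ℚᵘ.1ℚᵘ}
    (ℚᵘ.*≡* (cancel (+ suc d))))
  where
  cancel : ∀ D → (D ℤ.* + 1) ℤ.* + 1 ≡ + 1 ℤ.* (+ 1 ℤ.* D)
  cancel = solve-∀

ι-/ : ∀ {a z} d .{{_ : NonZero d}} → a ≡ z ℤ.* + d → ι a * (+ 1 / d) ≡ ι z
ι-/ {z = z} d refl = begin
  ι (z ℤ.* + d) * (+ 1 / d)   ≡⟨ cong (_* (+ 1 / d)) (ι-* z (+ d)) ⟩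
  ι z * ι (+ d) * (+ 1 / d)   ≡⟨ *-assoc (ι z) (ι (+ d)) (+ 1 / d) ⟩
  ι z * (ι (+ d) * (+ 1 / d)) ≡⟨ cong (ι z *_) (ι-*-inverse d) ⟩
  ι z * 1ℚ                    ≡⟨ *-identityʳ (ι z) ⟩
  ι z                         ∎
  where open ≡-Reasoning

ι-weighted-sum : ∀ a b c x y w →
  ι (a ℤ.* x ℤ.+ b ℤ.* y ℤ.+ c ℤ.* w) ≡ ι a * ι x + ι b * ι y + ι c * ι w
ι-weighted-sum a b c x y w = begin
  ι (a ℤ.* x ℤ.+ b ℤ.* y ℤ.+ c ℤ.* w)     ≡⟨ ι-+ (a ℤ.* x ℤ.+ b ℤ.* y) (c ℤ.* w) ⟩
  ι (a ℤ.* x ℤ.+ b ℤ.* y) + ι (c ℤ.* w)   ≡⟨ cong₂ _+_ (ι-+ (a ℤ.* x) (b ℤ.* y)) (ι-* c w) ⟩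
  ι (a ℤ.* x) + ι (b ℤ.* y) + ι c * ι w   ≡⟨ cong₂ (λ u v → u + v + ι c * ι w) (ι-* a x) (ι-* b y) ⟩
  ι a * ι x + ι b * ι y + ι c * ι w       ∎
  where open ≡-Reasoning

ι-weighted-sum-/ : ∀ {a b c x y w z} {u v t : ℚ} d .{{_ : NonZero d}} →
  u ≡ ι x → v ≡ ι y → t ≡ ι w → a ℤ.* x ℤ.+ b ℤ.* y ℤ.+ c ℤ.* w ≡ z ℤ.* + d →
  (ι a * u + ι b * v + ι c * t) * (+ 1 / d) ≡ ι z
ι-weighted-sum-/ {a} {b} {c} {x} {y} {w} {z} d refl refl refl eq =
  trans (cong (_* (+ 1 / d)) (sym (ι-weighted-sum a b c x y w))) (ι-/ {z = z} d eq)

cong-coefficients : ∀ {a a′ b b′ c c′ : ℤ} x y w → a ≡ a′ → b ≡ b′ → c ≡ c′ →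
  a ℤ.* x ℤ.+ b ℤ.* y ℤ.+ c ℤ.* w ≡ a′ ℤ.* x ℤ.+ b′ ℤ.* y ℤ.+ c′ ℤ.* w
cong-coefficients x y w refl refl refl = refl

P-suc-even : ∀ m k → isOdd (suc (suc m)) ≡ false → let n = suc (suc m) in ∀ {e₀ e₁ l z} →
  P n k ≡ ι e₀ → P n (suc k) ≡ ι e₁ → ell (suc m) k ≡ ι l →
  + 4 ℤ.* (+ k ℤ.+ + n) ℤ.* e₀ ℤ.+ + 2 ℤ.* (+ 2 ℤ.* + k ℤ.+ + n ℤ.+ + 1) ℤ.* e₁
    ℤ.+ (+ 4 ℤ.* + k ℤ.+ + n) ℤ.* l
    ≡ z ℤ.* + 4 →
  P (suc n) k ≡ ι z
P-suc-even m k even {e₀} {e₁} {l} {z} p₀ p₁ pℓ eq =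
  trans (if-cong even)
    (ι-weighted-sum-/ {+ (4 ℕ.* (k ℕ.+ n))} {+ (2 ℕ.* (2 ℕ.* k ℕ.+ n ℕ.+ 1))} {+ (4 ℕ.* k ℕ.+ n)}
                      {e₀} {e₁} {l} {z} 4 p₀ p₁ pℓ
      (trans (cong-coefficients e₀ e₁ l (pos-* 4 (k ℕ.+ n)) middle (cong (ℤ._+ + n) (pos-* 4 k))) eq))
  where
  n = suc (suc m)
  middle : + (2 ℕ.* (2 ℕ.* k ℕ.+ n ℕ.+ 1)) ≡ + 2 ℤ.* (+ 2 ℤ.* + k ℤ.+ + n ℤ.+ + 1)
  middle = trans (pos-* 2 (2 ℕ.* k ℕ.+ n ℕ.+ 1)) (cong (λ t → + 2 ℤ.* (t ℤ.+ + n ℤ.+ + 1)) (pos-* 2 k))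

P-suc-odd : ∀ m k → isOdd (suc (suc m)) ≡ true → let n = suc (suc m) in ∀ {e₀ e₁ l z} →
  P n k ≡ ι e₀ → P n (suc k) ≡ ι e₁ → ell n k ≡ ι l →
  + 2 ℤ.* (+ k ℤ.+ + n) ℤ.* e₀ ℤ.+ (+ 2 ℤ.* + k ℤ.+ + n) ℤ.* e₁
    ℤ.+ (+ 4 ℤ.* + k ℤ.+ + n) ℤ.* l
    ≡ z ℤ.* (+ 4 ℤ.* (+ n ℤ.+ + 2 ℤ.* + k)) →
  P (suc n) k ≡ ι z
P-suc-odd m k odd {e₀} {e₁} {l} {z} p₀ p₁ pℓ eq =
  trans (if-cong odd)
    (ι-weighted-sum-/ {+ (2 ℕ.* (k ℕ.+ n))} {+ (2 ℕ.* k ℕ.+ n)} {+ (4 ℕ.* k ℕ.+ n)}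
                      {e₀} {e₁} {l} {z} (4 ℕ.* (n ℕ.+ 2 ℕ.* k)) p₀ p₁ pℓ
      (trans (cong-coefficients e₀ e₁ l
               (pos-* 2 (k ℕ.+ n)) (cong (ℤ._+ + n) (pos-* 2 k)) (cong (ℤ._+ + n) (pos-* 4 k)))
             (trans eq (cong (z ℤ.*_) (sym denominator)))))
  where
  n = suc (suc m)
  denominator : + (4 ℕ.* (n ℕ.+ 2 ℕ.* k)) ≡ + 4 ℤ.* (+ n ℤ.+ + 2 ℤ.* + k)
  denominator = trans (pos-* 4 (n ℕ.+ 2 ℕ.* k)) (cong (λ t → + 4 ℤ.* (+ n ℤ.+ t)) (pos-* 2 k))

ell-even : ∀ r k → ell (suc (r ℕ.+ r)) k ≡ ι (ℓ r k)
ell-even r k =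
  trans (cong (λ h → q (prodShift h k)) (sym (n≡⌊n+n/2⌋ r)))
        (cong ι (sym (ℓ≡prodShift r k)))

ell-odd : ∀ r k → ell (suc (suc (suc (r ℕ.+ r)))) k ≡ ι (ℓ (suc r) k)
ell-odd r k =
  trans (cong (λ h → q (prodShift (suc h) k)) (sym (n≡⌊n+n/2⌋ r)))
        (cong ι (sym (ℓ≡prodShift (suc r) k)))

mutual
  P≡Peven : ∀ r k → P (suc (suc (r ℕ.+ r))) k ≡ ι (Peven r k)
  P≡Peven zero    k = refl
  P≡Peven (suc r) k =
    subst (λ t → P (suc (suc (suc t))) k ≡ ι (Peven (suc r) k)) (sym (+-suc r r))
      (P-suc-odd (suc (r ℕ.+ r)) k (trans (isOdd-suc-suc (suc (r ℕ.+ r))) (cong not (isOdd-double r)))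
        {Podd r k} {Podd r (suc k)} {ℓ (suc r) k} {Peven (suc r) k}
        (P≡Podd r k) (P≡Podd r (suc k)) (ell-odd r k) (recurrence-odd r k))

  P≡Podd : ∀ r k → P (suc (suc (suc (r ℕ.+ r)))) k ≡ ι (Podd r k)
  P≡Podd r k =
    P-suc-even (r ℕ.+ r) k (trans (isOdd-suc-suc (r ℕ.+ r)) (isOdd-double r))
      {Peven r k} {Peven r (suc k)} {ℓ r k} {Podd r k}
      (P≡Peven r k) (P≡Peven r (suc k)) (ell-even r k) (recurrence-even r k)

P-difference : ∀ r k → let n = suc (suc (suc (r ℕ.+ r))) in
  P n k - P n 0 ≡ q n * ι (partialSum (Peven r) k)
P-difference r k = begin
  P n k - P n 0                       ≡⟨ cong₂ _-_ (P≡Podd r k) (P≡Podd r 0) ⟩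
  ι (Podd r k) - ι (Podd r 0)         ≡⟨ sym (ι-- (Podd r k) (Podd r 0)) ⟩
  ι (Podd r k ℤ.- Podd r 0)           ≡⟨ cong ι (telescope (Podd r) (Peven r) (+ n) (Podd-step r) k) ⟩
  ι (+ n ℤ.* partialSum (Peven r) k)  ≡⟨ ι-* (+ n) (partialSum (Peven r) k) ⟩
  q n * ι (partialSum (Peven r) k)    ∎
  where
  open ≡-Reasoning
  n = suc (suc (suc (r ℕ.+ r)))

proposition1 : (n k : ℕ) → n ≥ 3 → isOdd n ≡ true →
    ∃ λ (m : ℤ) → P n k - P n 0 ≡ q n * (m / 1)
proposition1 n k n≥3 odd with odd≥3⇒suc-double n≥3 odd
... | r , refl = partialSum (Peven r) k , P-difference r k
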